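{- Let $a_0,a_1,\ldots$ be complex numbers and define $\tilde a_n=\sum_{k=0}^n\binom nk^2\binom{n+k}k^2a_k$ for $n\in\mathbb N$. Then for any positive integer $n$, $$\frac1{n^2}\sum_{k=0}^{n-1}(2k+1)\tilde a_k=\sum_{k=0}^{n-1}\frac{a_k}{2k+1}\binom{n-1}k^2\binom{n+k}k^2.$$ -}

module Defs where

open import Level using (Level)
open import Data.Nat using (ℕ; zero; suc; _+_; _*_; _^_; NonZero)
open import Data.Nat.Combinatorics using (_C_)
open import Data.Integer using (+_)
open import Data.Rational using (ℚ; _/_) renaming (_*_ to _*ℚ_)
open import Data.Rational.Properties using (+-*-commutativeRing)
open import Algebra.Module.Bundles using (Module)

-- A vector space over ℚ (ℚ-module).  ℂ is such a module.
QModule : (m ℓm : Level) → Set _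
QModule m ℓm = Module +-*-commutativeRing m ℓm

ℕ→ℚ : ℕ → ℚ
ℕ→ℚ n = + n / 1

inv2k+1 : ℕ → ℚ
inv2k+1 k = + 1 / suc (2 * k)

module _ {m ℓm : Level} (M : QModule m ℓm) where
  open Module M

  sumᴹ : ℕ → (ℕ → Carrierᴹ) → Carrierᴹ
  sumᴹ zero    f = 0ᴹ
  sumᴹ (suc n) f = sumᴹ n f +ᴹ f n

  tilde : (ℕ → Carrierᴹ) → ℕ → Carrierᴹ
  tilde a n = sumᴹ (suc n) (λ k → ℕ→ℚ (((n C k) ^ 2) * (((n + k) C k) ^ 2)) *ₗ a k)

  lhs : (ℕ → Carrierᴹ) → (n : ℕ) → .{{NonZero n}} → Carrierᴹ
  lhs a n = (+ 1 / n *ℚ (+ 1 / n)) *ₗ sumᴹ n (λ k → ℕ→ℚ (suc (2 * k)) *ₗ tilde a k)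

  rhs : (ℕ → Carrierᴹ) → ℕ → Carrierᴹ
  rhs a n = sumᴹ n (λ k → (inv2k+1 k *ℚ ℕ→ℚ ((((n ∸ 1) C k) ^ 2) * (((n + k) C k) ^ 2))) *ₗ a k)
    where open import Data.Nat using (_∸_)

module Submission where

-- Exchanging the order of summation, the left-hand side times n² equals
-- Σ_{j<n} r n j · a_j for explicit rational weights r n j; comparing
-- coefficients of a_j, it suffices to know that the weights
-- R n j = n² C(n-1,j)² C(n+j,j)² satisfy the telescoping recurrence
--
--   R n j + (2j+1)(2n+1) C(n,j)² C(n+j,j)² = R (n+1) j,      R n n = 0.

open import Defs
open import Level using (Level)
open import Algebra.Module.Bundles using (Module)
open import Data.Nat using (ℕ; suc; NonZero)
open import Data.Nat.Combinatorics
  using (_C_; nCk+nC[k+1]≡[n+1]C[k+1]; nCk≡nC[n∸k]; nC1≡n; k>n⇒nCk≡0)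
open import Relation.Binary.PropositionalEquality
import Relation.Binary.Reasoning.Setoid as SetoidReasoning

module Binomial where
  open import Data.Nat
  open import Data.Nat.Properties
  open ≡-Reasoning

  absorption        : ∀ n k → suc k * (suc n C suc k) ≡ suc n * (n C k)
  pascal-absorption : ∀ n k → k * (suc n C k) + suc n * (n C k) ≡ suc n * (suc n C k)

  absorption zero    zero    = refl
  absorption zero    (suc k) = *-zeroʳ (2 + k)
  absorption (suc n) zero    = begin
    1 * (suc (suc n) C 1) ≡⟨ *-identityˡ _ ⟩
    suc (suc n) C 1       ≡⟨ nC1≡n (suc (suc n)) ⟩
    suc (suc n)           ≡⟨ *-identityʳ (suc (suc n)) ⟨
    suc (suc n) * 1       ∎
  absorption (suc n) (suc k) = begin
    suc (suc k) * (suc (suc n) C suc (suc k))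
      ≡⟨ cong (suc (suc k) *_) (nCk+nC[k+1]≡[n+1]C[k+1] (suc n) (suc k)) ⟨
    suc (suc k) * (suc n C suc k + suc n C suc (suc k))
      ≡⟨ *-distribˡ-+ (suc (suc k)) (suc n C suc k) _ ⟩
    suc (suc k) * (suc n C suc k) + suc (suc k) * (suc n C suc (suc k))
      ≡⟨ cong (suc (suc k) * (suc n C suc k) +_) (absorption n (suc k)) ⟩
    suc (suc k) * (suc n C suc k) + suc n * (n C suc k)
      ≡⟨ +-assoc (suc n C suc k) (suc k * (suc n C suc k)) _ ⟩
    suc n C suc k + (suc k * (suc n C suc k) + suc n * (n C suc k))
      ≡⟨ cong (suc n C suc k +_) (pascal-absorption n (suc k)) ⟩
    suc (suc n) * (suc n C suc k) ∎

  pascal-absorption n zero    = refl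
  pascal-absorption n (suc k) = begin
    suc k * (suc n C suc k) + suc n * (n C suc k)
      ≡⟨ cong (_+ suc n * (n C suc k)) (absorption n k) ⟩
    suc n * (n C k) + suc n * (n C suc k)
      ≡⟨ *-distribˡ-+ (suc n) (n C k) _ ⟨
    suc n * (n C k + n C suc k)
      ≡⟨ cong (suc n *_) (nCk+nC[k+1]≡[n+1]C[k+1] n k) ⟩
    suc n * (suc n C suc k) ∎

  -- (n - k)·C(n,k) = n·C(n-1,k), written without truncated subtraction.
  pred-absorption : ∀ n k → n * ((n ∸ 1) C k) + k * (n C k) ≡ n * (n C k)
  pred-absorption zero    zero    = refl
  pred-absorption zero    (suc k) = *-zeroʳ (suc k)
  pred-absorption (suc n) k       =
    trans (+-comm (suc n * (n C k)) _) (pascal-absorption n k)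

  binomial-symmetry : ∀ m n → (m + n) C m ≡ (m + n) C n
  binomial-symmetry m n = begin
    (m + n) C m           ≡⟨ nCk≡nC[n∸k] (m≤m+n m n) ⟩
    (m + n) C (m + n ∸ m) ≡⟨ cong ((m + n) C_) (m+n∸m≡n m n) ⟩
    (m + n) C n           ∎

  shifted-absorption : ∀ n k → suc n * ((suc n + k) C k) ≡ suc (n + k) * ((n + k) C k)
  shifted-absorption n k = begin
    suc n * ((suc n + k) C k)     ≡⟨ cong (suc n *_) (binomial-symmetry (suc n) k) ⟨
    suc n * (suc (n + k) C suc n) ≡⟨ absorption (n + k) n ⟩
    suc (n + k) * ((n + k) C n)   ≡⟨ cong (suc (n + k) *_) (binomial-symmetry n k) ⟩
    suc (n + k) * ((n + k) C k)   ∎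

module Weights where
  open import Data.Nat
  open import Data.Nat.Properties using (*-zeroʳ; n<1+n; ^-identityʳ)
  open import Data.Nat.Tactic.RingSolver using (solve)
  open import Data.List using (_∷_; [])
  open ≡-Reasoning
  open Binomial

  c : ℕ → ℕ → ℕ
  c n k = ((n C k) ^ 2) * (((n + k) C k) ^ 2)

  d : ℕ → ℕ → ℕ
  d n k = (((n ∸ 1) C k) ^ 2) * (((n + k) C k) ^ 2)

  R : ℕ → ℕ → ℕ
  R n k = n * (n * d n k)

  completing-the-square : ∀ n k u X → u + k * X ≡ n * X →
    u * u + suc (2 * k) * (suc (2 * n) * (X * X)) ≡ (suc (n + k) * X) * (suc (n + k) * X)
  completing-the-square n k u X u+kX≡nX = begin
    u * u + suc (2 * k) * (suc (2 * n) * (X * X))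
      ≡⟨ solve (n ∷ k ∷ u ∷ X ∷ []) ⟩
    u * u + suc (2 * k) * X * (2 * (n * X) + X)
      ≡⟨ cong (λ w → u * u + suc (2 * k) * X * (2 * w + X)) u+kX≡nX ⟨
    u * u + suc (2 * k) * X * (2 * (u + k * X) + X)
      ≡⟨ solve (k ∷ u ∷ X ∷ []) ⟩
    (u + k * X + suc k * X) * (u + k * X + suc k * X)
      ≡⟨ cong (λ w → (w + suc k * X) * (w + suc k * X)) u+kX≡nX ⟩
    (n * X + suc k * X) * (n * X + suc k * X)
      ≡⟨ solve (n ∷ k ∷ X ∷ []) ⟩
    (suc (n + k) * X) * (suc (n + k) * X) ∎

  -- Squares as products (the ring solver does not expand ℕ's _^_).
  square : ∀ x → x ^ 2 ≡ x * x
  square x = cong (x *_) (^-identityʳ x)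

  -- The recurrence for R, with the binomial coefficients abstracted to
  -- C₁ = C(n-1,k), X = C(n,k), Y = C(n+k,k), Z = C(n+1+k,k).
  recurrence-core : ∀ n k C₁ X Y Z →
    n * C₁ + k * X ≡ n * X → suc n * Z ≡ suc (n + k) * Y →
    n * (n * ((C₁ ^ 2) * (Y ^ 2))) + suc (2 * k) * (suc (2 * n) * ((X ^ 2) * (Y ^ 2)))
      ≡ suc n * (suc n * ((X ^ 2) * (Z ^ 2)))
  recurrence-core n k C₁ X Y Z lower upper
    rewrite square C₁ | square X | square Y | square Z = begin
    n * (n * (C₁ * C₁ * (Y * Y))) + suc (2 * k) * (suc (2 * n) * (X * X * (Y * Y)))
      ≡⟨ solve (n ∷ k ∷ C₁ ∷ X ∷ Y ∷ []) ⟩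
    (n * C₁ * (n * C₁) + suc (2 * k) * (suc (2 * n) * (X * X))) * (Y * Y)
      ≡⟨ cong (_* (Y * Y)) (completing-the-square n k (n * C₁) X lower) ⟩
    (suc (n + k) * X) * (suc (n + k) * X) * (Y * Y)
      ≡⟨ solve (n ∷ k ∷ X ∷ Y ∷ []) ⟩
    (X * X) * ((suc (n + k) * Y) * (suc (n + k) * Y))
      ≡⟨ cong (λ w → (X * X) * (w * w)) upper ⟨
    (X * X) * ((suc n * Z) * (suc n * Z))
      ≡⟨ solve (n ∷ X ∷ Z ∷ []) ⟩
    suc n * (suc n * (X * X * (Z * Z))) ∎

  recurrence : ∀ n k → R n k + suc (2 * k) * (suc (2 * n) * c n k) ≡ R (suc n) k
  recurrence n k = recurrence-core n k _ _ _ _ (pred-absorption n k) (shifted-absorption n k)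

  R-diagonal : ∀ n → R n n ≡ 0
  R-diagonal zero    = refl
  R-diagonal (suc n) = begin
    R (suc n) (suc n)
      ≡⟨ cong (λ x → suc n * (suc n * ((x ^ 2) * (((suc n + suc n) C suc n) ^ 2))))
              (k>n⇒nCk≡0 (n<1+n n)) ⟩
    suc n * (suc n * 0) ≡⟨ cong (suc n *_) (*-zeroʳ (suc n)) ⟩
    suc n * 0           ≡⟨ *-zeroʳ (suc n) ⟩
    0                   ∎

module RationalWeights where
  import Data.Nat as ℕ
  open import Data.Integer as ℤ using (+_)
  import Data.Integer.Properties as ℤP
  import Data.Nat.Coprimality as Coprimality
  open import Data.Rational using (ℚ; mkℚ; _/_; _+_; _*_; 1ℚ; 0ℚ)
  open import Data.Rational.Properties
    using (normalize-coprime; /-cong; *-inverseˡ; *-identityˡ; *-assoc; *-comm; *-distribˡ-+; *-zeroʳ)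
  open ≡-Reasoning
  open Weights using (c; d; R; recurrence; R-diagonal)

  ℕ→ℚ-normal : ∀ n → ℕ→ℚ n ≡ mkℚ (+ n) 0 (Coprimality.sym (Coprimality.1-coprimeTo n))
  ℕ→ℚ-normal n = normalize-coprime (Coprimality.sym (Coprimality.1-coprimeTo n))

  ℕ→ℚ-+ : ∀ m n → ℕ→ℚ (m ℕ.+ n) ≡ ℕ→ℚ m + ℕ→ℚ n
  ℕ→ℚ-+ m n rewrite ℕ→ℚ-normal m | ℕ→ℚ-normal n =
    /-cong {q₁ = 1} {q₂ = 1}
      (trans (ℤP.pos-+ m n) (sym (cong₂ ℤ._+_ (ℤP.*-identityʳ (+ m)) (ℤP.*-identityʳ (+ n))))) refl

  ℕ→ℚ-* : ∀ m n → ℕ→ℚ (m ℕ.* n) ≡ ℕ→ℚ m * ℕ→ℚ n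
  ℕ→ℚ-* m n rewrite ℕ→ℚ-normal m | ℕ→ℚ-normal n = /-cong {q₁ = 1} (ℤP.pos-* m n) refl

  reciprocal : ∀ d → (+ 1 / suc d) * ℕ→ℚ (suc d) ≡ 1ℚ
  reciprocal d rewrite ℕ→ℚ-normal (suc d) | normalize-coprime {1} {d} (Coprimality.1-coprimeTo (suc d)) =
    *-inverseˡ (mkℚ (+ suc d) 0 (Coprimality.sym (Coprimality.1-coprimeTo (suc d))))

  cancel : ∀ d x → (+ 1 / suc d) * ℕ→ℚ (suc d ℕ.* x) ≡ ℕ→ℚ x
  cancel d x = begin
    (+ 1 / suc d) * ℕ→ℚ (suc d ℕ.* x)          ≡⟨ cong ((+ 1 / suc d) *_) (ℕ→ℚ-* (suc d) x) ⟩
    (+ 1 / suc d) * (ℕ→ℚ (suc d) * ℕ→ℚ x)     ≡⟨ *-assoc (+ 1 / suc d) _ _ ⟨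
    ((+ 1 / suc d) * ℕ→ℚ (suc d)) * ℕ→ℚ x     ≡⟨ cong (_* ℕ→ℚ x) (reciprocal d) ⟩
    1ℚ * ℕ→ℚ x                                 ≡⟨ *-identityˡ (ℕ→ℚ x) ⟩
    ℕ→ℚ x                                      ∎

  -- Coefficient of a_k in Σ_{j<n} (2j+1) ã_j, namely R n k / (2k+1).
  r : ℕ → ℕ → ℚ
  r n k = inv2k+1 k * ℕ→ℚ (R n k)

  r-recurrence : ∀ n k → r n k + ℕ→ℚ (suc (2 ℕ.* n)) * ℕ→ℚ (c n k) ≡ r (suc n) k
  r-recurrence n k = begin
    i * ℕ→ℚ (R n k) + ℕ→ℚ s * ℕ→ℚ (c n k)
      ≡⟨ cong (λ x → i * ℕ→ℚ (R n k) + x) (ℕ→ℚ-* s (c n k)) ⟨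
    i * ℕ→ℚ (R n k) + ℕ→ℚ (s ℕ.* c n k)
      ≡⟨ cong (λ x → i * ℕ→ℚ (R n k) + x) (cancel (2 ℕ.* k) (s ℕ.* c n k)) ⟨
    i * ℕ→ℚ (R n k) + i * ℕ→ℚ (suc (2 ℕ.* k) ℕ.* (s ℕ.* c n k))
      ≡⟨ *-distribˡ-+ i _ _ ⟨
    i * (ℕ→ℚ (R n k) + ℕ→ℚ (suc (2 ℕ.* k) ℕ.* (s ℕ.* c n k)))
      ≡⟨ cong (i *_) (ℕ→ℚ-+ (R n k) _) ⟨
    i * ℕ→ℚ (R n k ℕ.+ suc (2 ℕ.* k) ℕ.* (s ℕ.* c n k))
      ≡⟨ cong (λ x → i * ℕ→ℚ x) (recurrence n k) ⟩
    i * ℕ→ℚ (R (suc n) k) ∎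
    where
    i : ℚ
    i = inv2k+1 k
    s : ℕ.ℕ
    s = suc (2 ℕ.* n)

  r-diagonal : ∀ n → r n n ≡ 0ℚ
  r-diagonal n = trans (cong (λ x → inv2k+1 n * ℕ→ℚ x) (R-diagonal n)) (*-zeroʳ (inv2k+1 n))

  r-normalised : ∀ m k → (+ 1 / suc m * (+ 1 / suc m)) * r (suc m) k ≡ inv2k+1 k * ℕ→ℚ (d (suc m) k)
  r-normalised m k = begin
    (p * p) * (i * ℕ→ℚ (R (suc m) k)) ≡⟨ *-assoc (p * p) i _ ⟨
    ((p * p) * i) * ℕ→ℚ (R (suc m) k) ≡⟨ cong (_* ℕ→ℚ (R (suc m) k)) (*-comm (p * p) i) ⟩
    (i * (p * p)) * ℕ→ℚ (R (suc m) k) ≡⟨ *-assoc i (p * p) _ ⟩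
    i * ((p * p) * ℕ→ℚ (R (suc m) k)) ≡⟨ cong (i *_) (*-assoc p p _) ⟩
    i * (p * (p * ℕ→ℚ (R (suc m) k))) ≡⟨ cong (λ x → i * (p * x)) (cancel m (suc m ℕ.* d (suc m) k)) ⟩
    i * (p * ℕ→ℚ (suc m ℕ.* d (suc m) k)) ≡⟨ cong (i *_) (cancel m (d (suc m) k)) ⟩
    i * ℕ→ℚ (d (suc m) k) ∎
    where
    i p : ℚ
    i = inv2k+1 k
    p = + 1 / suc m

module Sums {m ℓm : Level} (M : QModule m ℓm) where
  open import Data.Nat using (zero)
  open import Data.Rational using (ℚ; _+_; _*_)
  open import Algebra.Bundles using (CommutativeMonoid)
  import Algebra.Properties.CommutativeSemigroup as CommutativeSemigroupProperties
  open Module M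
  open SetoidReasoning ≈ᴹ-setoid
  open CommutativeSemigroupProperties
    (CommutativeMonoid.commutativeSemigroup +ᴹ-commutativeMonoid) using (interchange)

  Σ : ℕ → (ℕ → Carrierᴹ) → Carrierᴹ
  Σ = sumᴹ M

  sum-cong : ∀ n {f g : ℕ → Carrierᴹ} → (∀ k → f k ≈ᴹ g k) → Σ n f ≈ᴹ Σ n g
  sum-cong zero    f≈g = ≈ᴹ-refl
  sum-cong (suc n) f≈g = +ᴹ-cong (sum-cong n f≈g) (f≈g n)

  sum-+ : ∀ n (f g : ℕ → Carrierᴹ) → Σ n (λ k → f k +ᴹ g k) ≈ᴹ Σ n f +ᴹ Σ n g
  sum-+ zero    f g = ≈ᴹ-sym (+ᴹ-identityʳ 0ᴹ)
  sum-+ (suc n) f g = begin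
    Σ n (λ k → f k +ᴹ g k) +ᴹ (f n +ᴹ g n) ≈⟨ +ᴹ-cong (sum-+ n f g) ≈ᴹ-refl ⟩
    (Σ n f +ᴹ Σ n g) +ᴹ (f n +ᴹ g n)       ≈⟨ interchange (Σ n f) (Σ n g) (f n) (g n) ⟩
    (Σ n f +ᴹ f n) +ᴹ (Σ n g +ᴹ g n)       ∎

  sum-scale : ∀ n (q : ℚ) (f : ℕ → Carrierᴹ) → q *ₗ Σ n f ≈ᴹ Σ n (λ k → q *ₗ f k)
  sum-scale zero    q f = *ₗ-zeroʳ q
  sum-scale (suc n) q f = ≈ᴹ-trans (*ₗ-distribˡ q (Σ n f) (f n)) (+ᴹ-cong (sum-scale n q f) ≈ᴹ-refl)

  sum-extend : ∀ n (f : ℕ → Carrierᴹ) → f n ≈ᴹ 0ᴹ → Σ n f ≈ᴹ Σ (suc n) f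
  sum-extend n f fn≈0 = ≈ᴹ-sym (≈ᴹ-trans (+ᴹ-cong ≈ᴹ-refl fn≈0) (+ᴹ-identityʳ (Σ n f)))

  collect : ∀ (p q t : ℚ) x → p *ₗ x +ᴹ q *ₗ (t *ₗ x) ≈ᴹ (p + q * t) *ₗ x
  collect p q t x = begin
    p *ₗ x +ᴹ q *ₗ (t *ₗ x) ≈⟨ +ᴹ-cong ≈ᴹ-refl (*ₗ-assoc q t x) ⟨
    p *ₗ x +ᴹ (q * t) *ₗ x  ≈⟨ *ₗ-distribʳ x p (q * t) ⟨
    (p + q * t) *ₗ x        ∎

module Exchange {m ℓm : Level} (M : QModule m ℓm) (a : ℕ → Module.Carrierᴹ M) where
  open import Data.Nat using (zero; _*_)
  open Module M
  open SetoidReasoning ≈ᴹ-setoid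
  open Sums M
  open import Data.Rational using (ℚ)
  open RationalWeights using (r; r-recurrence; r-diagonal)

  weighted-sum : ℕ → Carrierᴹ
  weighted-sum n = Σ n (λ k → ℕ→ℚ (suc (2 * k)) *ₗ tilde M a k)

  -- Σ_{k<n} (2k+1) ã_k = Σ_{j<n} r n j · a_j, by induction on n: the new
  -- term (2n+1) ã_n adds (2n+1)·c n j to each coefficient r n j.
  exchange : ∀ n → weighted-sum n ≈ᴹ Σ n (λ j → r n j *ₗ a j)
  exchange zero    = ≈ᴹ-refl
  exchange (suc n) = begin
    weighted-sum n +ᴹ s *ₗ tilde M a n
      ≈⟨ +ᴹ-cong (exchange n) (sum-scale (suc n) s _) ⟩
    Σ n (λ j → r n j *ₗ a j) +ᴹ Σ (suc n) (λ j → s *ₗ (ℕ→ℚ (c n j) *ₗ a j))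
      ≈⟨ +ᴹ-cong (sum-extend n (λ j → r n j *ₗ a j) diagonal-vanishes) ≈ᴹ-refl ⟩
    Σ (suc n) (λ j → r n j *ₗ a j) +ᴹ Σ (suc n) (λ j → s *ₗ (ℕ→ℚ (c n j) *ₗ a j))
      ≈⟨ sum-+ (suc n) _ _ ⟨
    Σ (suc n) (λ j → r n j *ₗ a j +ᴹ s *ₗ (ℕ→ℚ (c n j) *ₗ a j))
      ≈⟨ sum-cong (suc n) coefficient-step ⟩
    Σ (suc n) (λ j → r (suc n) j *ₗ a j) ∎
    where
    open Weights using (c)
    s : ℚ
    s = ℕ→ℚ (suc (2 * n))

    diagonal-vanishes : r n n *ₗ a n ≈ᴹ 0ᴹ
    diagonal-vanishes = ≈ᴹ-trans (*ₗ-cong (r-diagonal n) ≈ᴹ-refl) (*ₗ-zeroˡ (a n))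

    coefficient-step : ∀ j → r n j *ₗ a j +ᴹ s *ₗ (ℕ→ℚ (c n j) *ₗ a j) ≈ᴹ r (suc n) j *ₗ a j
    coefficient-step j = ≈ᴹ-trans (collect (r n j) s _ (a j)) (*ₗ-cong (r-recurrence n j) ≈ᴹ-refl)

lemma4p2 : {m ℓm : Level} (M : QModule m ℓm) (a : ℕ → Module.Carrierᴹ M)
           (n : ℕ) .{{_ : NonZero n}} →
           Module._≈ᴹ_ M (lhs M a n) (rhs M a n)
lemma4p2 M a (suc m) = begin
  q *ₗ weighted-sum (suc m)                          ≈⟨ *ₗ-cong refl (exchange (suc m)) ⟩
  q *ₗ Σ (suc m) (λ j → r (suc m) j *ₗ a j)         ≈⟨ sum-scale (suc m) q _ ⟩
  Σ (suc m) (λ j → q *ₗ (r (suc m) j *ₗ a j))       ≈⟨ sum-cong (suc m) normalise ⟩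
  rhs M a (suc m)                                    ∎
  where
  open Module M
  open SetoidReasoning ≈ᴹ-setoid
  open Sums M
  open Exchange M a
  open RationalWeights using (r; r-normalised)
  open import Data.Integer using (+_)
  open import Data.Rational using (ℚ; _/_; _*_)
  q : ℚ
  q = + 1 / suc m * (+ 1 / suc m)

  normalise : ∀ j → q *ₗ (r (suc m) j *ₗ a j) ≈ᴹ (inv2k+1 j * ℕ→ℚ (Weights.d (suc m) j)) *ₗ a j
  normalise j = ≈ᴹ-trans (≈ᴹ-sym (*ₗ-assoc q _ (a j))) (*ₗ-cong (r-normalised m j) ≈ᴹ-refl)
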